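{- Let $p$ be a prime and let $U\subseteq\mathbb F_p^2$ have cardinality $N=np-r$, where $n,r$ are integers with $1\leq n<p$, $r\geq 0$ and $p-r\geq n+1$. Then every point of $U$ is contained in a $U$-rich line.
   Context: A line of $\mathbb F_p^2$ is either a set $\{(u,v): v=mu-k\}$ with $m,k\in\mathbb F_p$ (slope $m$) or a vertical set $\{(u,v):u=c\}$ (slope $\infty$). For $U\subseteq\mathbb F_p^2$ put $\theta=\#U/p$. A line $\ell$ is $U$-rich if $\#(\ell\cap U)\geq\theta+1$. -}

module Defs where

open import Data.Nat using (ℕ; _+_; _*_; _%_; _≤_; NonZero)
open import Data.Fin using (Fin; toℕ)
open import Data.Bool using (Bool; true; false; _∧_)
open import Data.List using (List; map; sum; allFin; filter; length)
open import Data.Product using (_×_; _,_)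
open import Relation.Binary.PropositionalEquality using (_≡_)
open import Data.Fin using (_≟_)
open import Data.Nat using () renaming (_≟_ to _≟ℕ_)
open import Relation.Nullary.Decidable using (⌊_⌋)

-- Points of F_p^2 are pairs (u , v) of elements of Fin p, with F_p = ℤ/pℤ
-- represented by Fin p (canonical residues 0..p-1).
Point : ℕ → Set
Point p = Fin p × Fin p

SubsetF2 : ℕ → Set
SubsetF2 p = Point p → Bool

allPoints : (p : ℕ) → List (Point p)
allPoints p = Data.List.concatMap (λ u → map (λ v → (u , v)) (allFin p)) (allFin p)

card : (p : ℕ) → SubsetF2 p → ℕ
card p U = length (filter (λ x → Data.Bool._≟_ (U x) true) (allPoints p))

-- Lines of F_p^2: either slope m with intercept k ({v = m u - k}), or vertical {u = c}.
data Line (p : ℕ) : Set where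
  sloped   : (m k : Fin p) → Line p
  vertical : (c : Fin p) → Line p

-- Membership of a point in a line (arithmetic in F_p = ℤ/pℤ):
-- v = m u - k  in F_p   iff   (v + k) mod p = (m u) mod p.
onLine : (p : ℕ) .{{_ : NonZero p}} → Line p → Point p → Bool
onLine p (sloped m k) (u , v) = ⌊ ((toℕ v + toℕ k) % p) ≟ℕ ((toℕ m * toℕ u) % p) ⌋
onLine p (vertical c) (u , v) = ⌊ u ≟ c ⌋

cardOn : (p : ℕ) .{{_ : NonZero p}} → Line p → SubsetF2 p → ℕ
cardOn p ℓ U = card p (λ x → onLine p ℓ x ∧ U x)

-- ℓ is U-rich iff #(ℓ ∩ U) ≥ θ + 1 with θ = #U / p,
-- equivalently (multiplying by p > 0): #U + p ≤ p · #(ℓ ∩ U).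
Rich : (p : ℕ) .{{_ : NonZero p}} → SubsetF2 p → Line p → Set
Rich p U ℓ = card p U + p ≤ p * cardOn p ℓ U

-- The p + 1 lines through a point x of U (its pencil) cover the plane. Counting incidences,
-- the #(ℓ ∩ U) over the pencil add up to at least N + p, since x is counted p + 1 times and
-- every other point of U at least once. A line that is not U-rich meets U in at most n
-- points, so without a rich line the total is at most (p + 1) n; then np − r + p ≤ (p + 1) n,
-- i.e. p ≤ n + r, against p − r ≥ n + 1.
-- Primality enters only in showing that the pencil covers the plane.
module Submission where

open import Defs
open import Data.Nat using (ℕ; _+_; _*_; _∸_; _≤_; _<_; NonZero)
open import Data.Nat.Primality using (Prime; euclidsLemma)
open import Data.Bool using (true)
open import Data.Product using (Σ; _×_)
open import Relation.Binary.PropositionalEquality using (_≡_)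

open import Data.Bool as Bool using (Bool; false; _∧_)
open import Data.Fin using (Fin; toℕ; punchOut; _≟_)
open import Data.Fin.Properties using (any?; toℕ<n; toℕ-injective; toℕ-fromℕ<; punchOut-injective; <⇒notInjective)
open import Data.List using (List; []; _∷_; map; filter; length; allFin)
open import Data.List.Membership.Propositional using (_∈_; find; lose)
open import Data.List.Membership.Propositional.Properties using (∈-allFin; ∈-map⁺; ∈-concatMap⁺)
open import Data.List.Properties using (length-map; length-tabulate; map-cong)
open import Data.List.Relation.Unary.All as All using (All; []; _∷_)
import Data.List.Relation.Unary.All.Properties as All using (¬Any⇒All¬; map⁺)
open import Data.List.Relation.Unary.Any as Any using (Any; here; there)
import Data.List.Relation.Unary.Any.Properties as Any using (map⁺)
open import Data.Nat using (suc; z≤n; s≤s⁻¹; _%_; _/_; _≤?_)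
open import Data.Nat.DivMod using (_mod_; m≡m%n+[m/n]*n; m%n<n; m<n⇒m%n≡m; m%n%n≡m%n; n%n≡0; m*n%n≡0; %-distribˡ-+; [m+n]%n≡m%n; [m+kn]%n≡m%n; %-remove-+ˡ)
open import Data.Nat.Divisibility using (_∣_; divides; n∣m⇒m%n≡0)
open import Data.Nat.ListAction using (sum)
open import Data.Nat.Properties hiding (_≟_)
open import Algebra.Properties.CommutativeSemigroup +-commutativeSemigroup using (interchange)
open import Data.Nat.Tactic.RingSolver using (solve-∀)
open import Data.Product using (∃; _,_; proj₁; proj₂)
open import Data.Sum using (inj₁; inj₂)
open import Function using (_∘_)
open import Function.Definitions using (Injective; Surjective)
open import Relation.Nullary using (Dec; yes; no; ¬_; contradiction)
open import Relation.Nullary.Decidable using (⌊_⌋; isYes≗does; dec-true)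
open import Relation.Binary.PropositionalEquality using (_≢_; refl; sym; trans; cong; cong₂; subst; module ≡-Reasoning)

𝟙 : Bool → ℕ
𝟙 true  = 1
𝟙 false = 0

⌊⌋-true : ∀ {A : Set} (a? : Dec A) → A → ⌊ a? ⌋ ≡ true
⌊⌋-true a? a = trans (isYes≗does a?) (dec-true a? a)

module _ {A : Set} where

  length-filter≡sum-𝟙 : (f : A → Bool) (xs : List A) →
                        length (filter (λ y → f y Bool.≟ true) xs) ≡ sum (map (𝟙 ∘ f) xs)
  length-filter≡sum-𝟙 f []       = refl
  length-filter≡sum-𝟙 f (x ∷ xs) with f x
  ... | true  = cong suc (length-filter≡sum-𝟙 f xs)
  ... | false = length-filter≡sum-𝟙 f xs

  sum-map-+ : (f g : A → ℕ) (xs : List A) →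
              sum (map (λ y → f y + g y) xs) ≡ sum (map f xs) + sum (map g xs)
  sum-map-+ f g []       = refl
  sum-map-+ f g (x ∷ xs) =
    trans (cong (f x + g x +_) (sum-map-+ f g xs)) (interchange (f x) (g x) _ _)

  sum-map-const : ∀ {f : A → ℕ} {c} xs → All (λ y → f y ≡ c) xs → sum (map f xs) ≡ length xs * c
  sum-map-const []       []         = refl
  sum-map-const (x ∷ xs) (fx≡c ∷ h) = cong₂ _+_ fx≡c (sum-map-const xs h)

  sum-map-≤-const : ∀ {f : A → ℕ} {c} xs → All (λ y → f y ≤ c) xs → sum (map f xs) ≤ length xs * c
  sum-map-≤-const []       []         = z≤n
  sum-map-≤-const (x ∷ xs) (fx≤c ∷ h) = +-mono-≤ fx≤c (sum-map-≤-const xs h)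

  sum-map-mono : ∀ {f g : A → ℕ} → (∀ y → f y ≤ g y) → ∀ xs → sum (map f xs) ≤ sum (map g xs)
  sum-map-mono f≤g []       = z≤n
  sum-map-mono f≤g (x ∷ xs) = +-mono-≤ (f≤g x) (sum-map-mono f≤g xs)

  sum-map-mono-excess : ∀ {f g : A → ℕ} {x xs} k → x ∈ xs →
                        (∀ y → f y ≤ g y) → f x + k ≤ g x →
                        sum (map f xs) + k ≤ sum (map g xs)
  sum-map-mono-excess {f} {g} {xs = y ∷ ys} k (here refl) f≤g fx+k≤gx = begin
    f y + sum (map f ys) + k   ≡⟨ +-assoc (f y) _ k ⟩
    f y + (sum (map f ys) + k) ≡⟨ cong (f y +_) (+-comm _ k) ⟩
    f y + (k + sum (map f ys)) ≡⟨ +-assoc (f y) k _ ⟨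
    f y + k + sum (map f ys)   ≤⟨ +-mono-≤ fx+k≤gx (sum-map-mono f≤g ys) ⟩
    g y + sum (map g ys)       ∎
    where open ≤-Reasoning
  sum-map-mono-excess {f} {g} {xs = y ∷ ys} k (there x∈ys) f≤g fx+k≤gx = begin
    f y + sum (map f ys) + k   ≡⟨ +-assoc (f y) _ k ⟩
    f y + (sum (map f ys) + k) ≤⟨ +-mono-≤ (f≤g y) (sum-map-mono-excess k x∈ys f≤g fx+k≤gx) ⟩
    g y + sum (map g ys)       ∎
    where open ≤-Reasoning

  Any⇒≤sum-map : ∀ {f : A → ℕ} {c xs} → Any (λ y → c ≤ f y) xs → c ≤ sum (map f xs)
  Any⇒≤sum-map {f} {xs = x ∷ xs} (here c≤fx)  = ≤-trans c≤fx (m≤m+n (f x) _)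
  Any⇒≤sum-map {f} {xs = x ∷ xs} (there c≤fy) = ≤-trans (Any⇒≤sum-map c≤fy) (m≤n+m _ (f x))

sum-map-swap : ∀ {A B : Set} (F : A → B → ℕ) xs ys →
               sum (map (λ x → sum (map (F x) ys)) xs) ≡ sum (map (λ y → sum (map (λ x → F x y) xs)) ys)
sum-map-swap F []       ys = sym (trans (sum-map-const ys (All.universal (λ _ → refl) ys)) (*-zeroʳ (length ys)))
sum-map-swap F (x ∷ xs) ys =
  trans (cong (sum (map (F x) ys) +_) (sum-map-swap F xs ys)) (sym (sum-map-+ (F x) _ ys))

injective⇒surjective : ∀ {n} {f : Fin n → Fin n} → Injective _≡_ _≡_ f → Surjective _≡_ _≡_ f
injective⇒surjective {suc n} {f} f-inj t with any? (λ i → f i ≟ t)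
... | yes (i , fi≡t) = i , λ { refl → fi≡t }
... | no t∉f[Fin] = contradiction (λ {i j} → g-injective {i} {j}) (<⇒notInjective (n<1+n n))
  where
  t≢f : ∀ i → t ≢ f i
  t≢f i t≡fi = t∉f[Fin] (i , sym t≡fi)

  g : Fin (suc n) → Fin n
  g i = punchOut (t≢f i)

  g-injective : Injective _≡_ _≡_ g
  g-injective {i} {j} gi≡gj = f-inj (punchOut-injective (t≢f i) (t≢f j) gi≡gj)

module _ {p : ℕ} .{{_ : NonZero p}} where

  toℕ-mod : ∀ x → toℕ (x mod p) ≡ x % p
  toℕ-mod x = toℕ-fromℕ< (m%n<n x p)

  %-congˡ-+ : ∀ {x x′} y → x % p ≡ x′ % p → (x + y) % p ≡ (x′ + y) % p
  %-congˡ-+ {x} {x′} y x≡x′ = begin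
    (x + y) % p             ≡⟨ %-distribˡ-+ x y p ⟩
    (x % p + y % p) % p     ≡⟨ cong (λ z → (z + y % p) % p) x≡x′ ⟩
    (x′ % p + y % p) % p    ≡⟨ %-distribˡ-+ x′ y p ⟨
    (x′ + y) % p            ∎
    where open ≡-Reasoning

  %≡%⇒∣∸ : ∀ {x y} → x % p ≡ y % p → p ∣ y ∸ x
  %≡%⇒∣∸ {x} {y} x≡y = divides (y / p ∸ x / p) (begin
    y ∸ x                                     ≡⟨ cong₂ _∸_ (m≡m%n+[m/n]*n y p) (m≡m%n+[m/n]*n x p) ⟩
    (y % p + y / p * p) ∸ (x % p + x / p * p) ≡⟨ cong (λ z → (z + y / p * p) ∸ (x % p + x / p * p)) (sym x≡y) ⟩
    (x % p + y / p * p) ∸ (x % p + x / p * p) ≡⟨ [m+n]∸[m+o]≡n∸o (x % p) _ _ ⟩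
    y / p * p ∸ x / p * p                     ≡⟨ *-distribʳ-∸ p (y / p) (x / p) ⟨
    (y / p ∸ x / p) * p                       ∎)
    where open ≡-Reasoning

  *-%-injective : Prime p → ∀ {d} → ¬ p ∣ d → ∀ {i j} → i < p → j < p →
                  i * d % p ≡ j * d % p → i ≡ j
  *-%-injective pr {d} p∤d {i} {j} i<p j<p id≡jd =
    ≤-antisym (m∸n≡0⇒m≤n (∸≡0 {j} {i} i<p (sym id≡jd))) (m∸n≡0⇒m≤n (∸≡0 {i} {j} j<p id≡jd))
    where
    ∸≡0 : ∀ {i j} → j < p → i * d % p ≡ j * d % p → j ∸ i ≡ 0
    ∸≡0 {i} {j} j<p id≡jd
      with euclidsLemma (j ∸ i) d pr (subst (p ∣_) (sym (*-distribʳ-∸ d j i)) (%≡%⇒∣∸ id≡jd))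
    ... | inj₁ p∣j∸i = trans (sym (m<n⇒m%n≡m (≤-<-trans (m∸n≤m j i) j<p))) (n∣m⇒m%n≡0 _ p p∣j∸i)
    ... | inj₂ p∣d   = contradiction p∣d p∤d

  linear-congruence-solvable : Prime p → ∀ {d} → ¬ p ∣ d → ∀ t → ∃ λ (m : Fin p) → toℕ m * d % p ≡ t % p
  linear-congruence-solvable pr {d} p∤d t =
    m , trans (sym (toℕ-mod (toℕ m * d))) (trans (cong toℕ hit) (toℕ-mod t))
    where
    multiply : Fin p → Fin p
    multiply m = (toℕ m * d) mod p

    multiply-injective : Injective _≡_ _≡_ multiply
    multiply-injective {i} {j} eq = toℕ-injective (*-%-injective pr p∤d (toℕ<n i) (toℕ<n j)
      (trans (sym (toℕ-mod (toℕ i * d))) (trans (cong toℕ eq) (toℕ-mod (toℕ j * d)))))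

    m : Fin p
    m = proj₁ (injective⇒surjective multiply-injective (t mod p))

    hit : multiply m ≡ t mod p
    hit = proj₂ (injective⇒surjective multiply-injective (t mod p)) refl

  -- u + (p ∸ a) stands for u − a in F_p; it avoids truncated subtraction.
  p∤u+[p∸a] : ∀ {u a} → u < p → a < p → u ≢ a → ¬ p ∣ u + (p ∸ a)
  p∤u+[p∸a] {u} {a} u<p a<p u≢a p∣d = u≢a (begin
    u                     ≡⟨ m<n⇒m%n≡m u<p ⟨
    u % p                 ≡⟨ [m+n]%n≡m%n u p ⟨
    (u + p) % p           ≡⟨ cong (λ z → (u + z) % p) (m∸n+n≡m (<⇒≤ a<p)) ⟨
    (u + (p ∸ a + a)) % p ≡⟨ cong (_% p) (+-assoc u (p ∸ a) a) ⟨
    (u + (p ∸ a) + a) % p ≡⟨ %-remove-+ˡ a p∣d ⟩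
    a % p                 ≡⟨ m<n⇒m%n≡m a<p ⟩
    a                     ∎)
    where open ≡-Reasoning

  -- The line v = m u − k of slope m passes through (a , b) iff k = m a − b.
  interceptThrough : Point p → Fin p → Fin p
  interceptThrough (a , b) m = (toℕ m * toℕ a + (p ∸ toℕ b)) mod p

  pencil : Point p → List (Line p)
  pencil x@(a , _) = vertical a ∷ map (λ m → sloped m (interceptThrough x m)) (allFin p)

  length-pencil : ∀ x → length (pencil x) ≡ suc p
  length-pencil x = cong suc (trans (length-map _ (allFin p)) (length-tabulate _))

  on-sloped-pencil-line : ∀ {a b u v : Fin p} m →
    toℕ m * (toℕ u + (p ∸ toℕ a)) % p ≡ (toℕ v + (p ∸ toℕ b)) % p →
    onLine p (sloped m (interceptThrough (a , b) m)) (u , v) ≡ true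
  on-sloped-pencil-line {a} {b} {u} {v} m slope = ⌊⌋-true _ (begin
    (V + toℕ (interceptThrough (a , b) m)) % p ≡⟨ cong (λ z → (V + z) % p) (toℕ-mod (M * A + (p ∸ B))) ⟩
    (V + (M * A + (p ∸ B)) % p) % p         ≡⟨ cong (_% p) (+-comm V _) ⟩
    ((M * A + (p ∸ B)) % p + V) % p         ≡⟨ %-congˡ-+ V (m%n%n≡m%n _ p) ⟩
    (M * A + (p ∸ B) + V) % p               ≡⟨ cong (_% p) (shuffle (M * A) (p ∸ B) V) ⟩
    (V + (p ∸ B) + M * A) % p               ≡⟨ %-congˡ-+ (M * A) (sym slope) ⟩
    (M * (U + (p ∸ A)) + M * A) % p         ≡⟨ cong (_% p) (distribute M U (p ∸ A) A) ⟩
    (M * U + M * (p ∸ A + A)) % p           ≡⟨ cong (λ z → (M * U + M * z) % p) (m∸n+n≡m (<⇒≤ (toℕ<n a))) ⟩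
    (M * U + M * p) % p                     ≡⟨ [m+kn]%n≡m%n (M * U) M p ⟩
    M * U % p                               ∎)
    where
    open ≡-Reasoning
    A B U V M : ℕ
    A = toℕ a
    B = toℕ b
    U = toℕ u
    V = toℕ v
    M = toℕ m
    shuffle : ∀ x y z → x + y + z ≡ z + y + x
    shuffle = solve-∀
    distribute : ∀ m u w a → m * (u + w) + m * a ≡ m * u + m * (w + a)
    distribute = solve-∀

  pencil-through : ∀ x → All (λ ℓ → onLine p ℓ x ≡ true) (pencil x)
  pencil-through (a , b) =
    ⌊⌋-true (a ≟ a) refl ∷ All.map⁺ (All.universal (λ m → on-sloped-pencil-line {a} {b} m (slope m)) (allFin p))
    where
    slope : ∀ m → toℕ m * (toℕ a + (p ∸ toℕ a)) % p ≡ (toℕ b + (p ∸ toℕ b)) % p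
    slope m = begin
      toℕ m * (toℕ a + (p ∸ toℕ a)) % p ≡⟨ cong (λ z → toℕ m * z % p) (m+[n∸m]≡n (<⇒≤ (toℕ<n a))) ⟩
      toℕ m * p % p                     ≡⟨ m*n%n≡0 (toℕ m) p ⟩
      0                                 ≡⟨ n%n≡0 p ⟨
      p % p                             ≡⟨ cong (_% p) (m+[n∸m]≡n (<⇒≤ (toℕ<n b))) ⟨
      (toℕ b + (p ∸ toℕ b)) % p         ∎
      where open ≡-Reasoning

  pencil-covers : Prime p → ∀ x y → Any (λ ℓ → onLine p ℓ y ≡ true) (pencil x)
  pencil-covers pr (a , b) (u , v) with u ≟ a
  ... | yes refl = here (⌊⌋-true (u ≟ u) refl)
  ... | no u≢a
    with m , slope ← linear-congruence-solvable pr (p∤u+[p∸a] (toℕ<n u) (toℕ<n a) (u≢a ∘ toℕ-injective))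
                                                (toℕ v + (p ∸ toℕ b))
    = there (Any.map⁺ (lose (∈-allFin m) (on-sloped-pencil-line {a} {b} m slope)))

∈-allPoints : ∀ {p} (x : Point p) → x ∈ allPoints p
∈-allPoints {p} (a , b) =
  ∈-concatMap⁺ (λ u → map (u ,_) (allFin p)) (Any.map (λ { refl → ∈-map⁺ (a ,_) (∈-allFin b) }) (∈-allFin a))

card+k≤sum-cardOn : ∀ {p} .{{_ : NonZero p}} (U : SubsetF2 p) {x} → U x ≡ true →
                    ∀ (ℓs : List (Line p)) {k} → length ℓs ≡ suc k →
                    All (λ ℓ → onLine p ℓ x ≡ true) ℓs →
                    (∀ y → Any (λ ℓ → onLine p ℓ y ≡ true) ℓs) →
                    card p U + k ≤ sum (map (λ ℓ → cardOn p ℓ U) ℓs)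
card+k≤sum-cardOn {p} U {x} Ux ℓs {k} |ℓs|≡1+k through covers = begin
  card p U + k                                     ≡⟨ cong (_+ k) (length-filter≡sum-𝟙 U (allPoints p)) ⟩
  sum (map (𝟙 ∘ U) (allPoints p)) + k              ≤⟨ sum-map-mono-excess k (∈-allPoints x) 𝟙∘U≤multiplicity excess-at-x ⟩
  sum (map multiplicity (allPoints p))             ≡⟨ sum-map-swap incident ℓs (allPoints p) ⟨
  sum (map (λ ℓ → sum (map (incident ℓ) (allPoints p))) ℓs)
    ≡⟨ cong sum (map-cong (λ ℓ → length-filter≡sum-𝟙 (λ y → onLine p ℓ y ∧ U y) (allPoints p)) ℓs) ⟨
  sum (map (λ ℓ → cardOn p ℓ U) ℓs)                ∎
  where
  open ≤-Reasoning

  incident : Line p → Point p → ℕ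
  incident ℓ y = 𝟙 (onLine p ℓ y ∧ U y)

  multiplicity : Point p → ℕ
  multiplicity y = sum (map (λ ℓ → incident ℓ y) ℓs)

  𝟙∘U≤multiplicity : ∀ y → 𝟙 (U y) ≤ multiplicity y
  𝟙∘U≤multiplicity y with U y
  ... | false = z≤n
  ... | true  = Any⇒≤sum-map (Any.map (λ on → ≤-reflexive (cong (λ b → 𝟙 (b ∧ true)) (sym on))) (covers y))

  excess-at-x : 𝟙 (U x) + k ≤ multiplicity x
  excess-at-x = ≤-reflexive (begin-equality
    𝟙 (U x) + k      ≡⟨ cong (λ b → 𝟙 b + k) Ux ⟩
    suc k            ≡⟨ |ℓs|≡1+k ⟨
    length ℓs        ≡⟨ *-identityʳ (length ℓs) ⟨
    length ℓs * 1    ≡⟨ sum-map-const ℓs (All.map (λ on → cong₂ (λ b c → 𝟙 (b ∧ c)) on Ux) through) ⟨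
    multiplicity x   ∎)

¬[N+p≤p*c]⇒c≤n : ∀ {N r n c} p → N + r ≡ n * p → ¬ (N + p ≤ p * c) → c ≤ n
¬[N+p≤p*c]⇒c≤n {N} {r} {n} {c} p N+r≡np N+p≰pc = s≤s⁻¹ (*-cancelˡ-< p c (suc n) (begin-strict
  p * c     <⟨ ≰⇒> N+p≰pc ⟩
  N + p     ≤⟨ +-monoˡ-≤ p (m≤m+n N r) ⟩
  N + r + p ≡⟨ cong (_+ p) N+r≡np ⟩
  n * p + p ≡⟨ +-comm (n * p) p ⟩
  p + n * p ≡⟨ cong (p +_) (*-comm n p) ⟩
  p + p * n ≡⟨ *-suc p n ⟨
  p * suc n ∎))
  where open ≤-Reasoning

N+p≰[1+p]*n : ∀ {N r n} p → N + r ≡ n * p → n + 1 + r ≤ p → ¬ (N + p ≤ suc p * n)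
N+p≰[1+p]*n {N} {r} {n} p N+r≡np n+1+r≤p N+p≤[1+p]n = <⇒≱ n+r<p (+-cancelˡ-≤ (n * p) p (n + r) (begin
  n * p + p       ≡⟨ cong (_+ p) N+r≡np ⟨
  N + r + p       ≡⟨ swap N r p ⟩
  N + p + r       ≤⟨ +-monoˡ-≤ r N+p≤[1+p]n ⟩
  suc p * n + r   ≡⟨ expand p n r ⟩
  n * p + (n + r) ∎))
  where
  open ≤-Reasoning
  n+r<p : n + r < p
  n+r<p = subst (λ m → m + r ≤ p) (+-comm n 1) n+1+r≤p
  swap : ∀ x y z → x + y + z ≡ x + z + y
  swap = solve-∀
  expand : ∀ p n r → suc p * n + r ≡ n * p + (n + r)
  expand = solve-∀

lemma2p3 : (p : ℕ) .{{_ : NonZero p}} → Prime p →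
    (U : SubsetF2 p) (n r : ℕ) →
    1 ≤ n → n < p → n + 1 + r ≤ p →
    card p U + r ≡ n * p →
    (x : Point p) → U x ≡ true →
    Σ (Line p) (λ ℓ → (onLine p ℓ x ≡ true) × Rich p U ℓ)
lemma2p3 p pr U n r _ _ n+1+r≤p N+r≡np x Ux
  with Any.any? (λ ℓ → card p U + p ≤? p * cardOn p ℓ U) (pencil x)
... | yes some-rich =
  let ℓ , ℓ∈pencil , rich = find some-rich in ℓ , All.lookup (pencil-through x) ℓ∈pencil , rich
... | no none-rich = contradiction (≤-trans many-incidences few-incidences) (N+p≰[1+p]*n p N+r≡np n+1+r≤p)
  where
  many-incidences : card p U + p ≤ sum (map (λ ℓ → cardOn p ℓ U) (pencil x))
  many-incidences = card+k≤sum-cardOn U Ux (pencil x) (length-pencil x) (pencil-through x) (pencil-covers pr x)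

  few-incidences : sum (map (λ ℓ → cardOn p ℓ U) (pencil x)) ≤ suc p * n
  few-incidences = subst (λ L → sum (map (λ ℓ → cardOn p ℓ U) (pencil x)) ≤ L * n) (length-pencil x)
    (sum-map-≤-const (pencil x) (All.map (¬[N+p≤p*c]⇒c≤n p N+r≡np) (All.¬Any⇒All¬ _ none-rich)))
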